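{- Let $s,t$ be positive integers with $\gcd(s,t)=1$. Then every integer $n\in[1,4s+4t]$ can be written as $n=1+is+jt$ for unique integers $i,j$ with $0\le j<s$ and $-jt/s\le i<4+(4-j)t/s$. -}

module Defs where

open import Data.Integer using (ℤ; +_; _+_; _*_; -_; _≤_; _<_)
open import Data.Nat using (ℕ)
open import Data.Product using (_×_)
open import Relation.Binary.PropositionalEquality using (_≡_)

-- Rep s t n i j : n = 1 + i s + j t, 0 ≤ j < s, and
--   -j t / s ≤ i < 4 + (4 - j) t / s,
-- with the two rational inequalities multiplied through by s > 0:
--   -(j t) ≤ i s   and   i s < 4 s + (4 - j) t.
Rep : ℕ → ℕ → ℤ → ℤ → ℤ → Set
Rep s t n i j =
  (n ≡ + 1 + i * + s + j * + t)
  × (+ 0 ≤ j) × (j < + s)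
  × (- (j * + t) ≤ i * + s)
  × (i * + s < + 4 * + s + (+ 4 + - j) * + t)

-- Since gcd(s, t) = 1, t is invertible modulo s, so the congruence n - 1 ≡ j t (mod s)
-- has exactly one solution j ∈ [0, s), and it determines i = (n - 1 - j t) / s.
-- Multiplied through by s, the two bounds on i say exactly 1 ≤ n and n ≤ 4s + 4t.
module Submission where

open import Defs
open import Data.Nat using (ℕ; NonZero) renaming (_+_ to _+ℕ_; _*_ to _*ℕ_)
open import Data.Nat.GCD using (gcd)
open import Data.Integer using (ℤ; +_; _≤_)
open import Data.Product using (Σ; _×_; _,_)
open import Relation.Binary.PropositionalEquality using (_≡_)

open import Data.Integer using (_+_; _*_; -_; _-_; _<_; ∣_∣; +≤+; +<+; 1ℤ)
import Data.Integer.Properties as ℤ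
open import Data.Integer.DivMod using (_%ℕ_; _/ℕ_; a≡a%ℕn+[a/ℕn]*n; n%ℕd<d)
open import Data.Integer.Tactic.RingSolver using (solve-∀)
import Data.Nat as ℕ
import Data.Nat.Properties as ℕ
open import Data.Nat.Divisibility using (divides; >⇒∤) renaming (_∣_ to _∣ℕ_)
open import Data.Nat.Coprimality using (Coprime; coprime-Bézout; coprime-divisor; gcd≡1⇒coprime)
open import Data.Nat.GCD using (module Bézout)
open import Data.Product using (∃₂; map₂)
open import Relation.Binary.PropositionalEquality
  using (refl; sym; trans; cong; cong₂; subst; module ≡-Reasoning)
open import Relation.Nullary using (contradiction)

1+m*n≡o*p⇒ℤ : ∀ m n o p → 1 +ℕ m *ℕ n ≡ o *ℕ p → 1ℤ + + m * + n ≡ + o * + p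
1+m*n≡o*p⇒ℤ m n o p eq = begin
  1ℤ + + m * + n   ≡⟨ cong (λ a → 1ℤ + a) (ℤ.pos-* m n) ⟨
  + (1 +ℕ m *ℕ n)  ≡⟨ cong +_ eq ⟩
  + (o *ℕ p)       ≡⟨ ℤ.pos-* o p ⟩
  + o * + p        ∎
  where open ≡-Reasoning

bézout-ℤ : ∀ {s t} → Coprime s t → ∃₂ λ x y → x * + s + y * + t ≡ 1ℤ
bézout-ℤ {s} {t} cop with coprime-Bézout cop
... | Bézout.+- x y 1+yt≡xs =
  + x , - + y ,
  trans (cong (_+ - + y * + t) (sym (1+m*n≡o*p⇒ℤ y t x s 1+yt≡xs))) (cancel (+ y) (+ t))
  where
  cancel : ∀ y t → (1ℤ + y * t) + - y * t ≡ 1ℤ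
  cancel = solve-∀
... | Bézout.-+ x y 1+xs≡yt =
  - + x , + y ,
  trans (cong (λ a → - + x * + s + a) (sym (1+m*n≡o*p⇒ℤ x s y t 1+xs≡yt))) (cancel (+ x) (+ s))
  where
  cancel : ∀ x s → - x * s + (1ℤ + x * s) ≡ 1ℤ
  cancel = solve-∀

-- With x s + y t = 1, write m y = j + q s (0 ≤ j < s); then m = (m x + q t) s + j t.
coprime⇒∃-linear-combination : ∀ {s t} .{{_ : NonZero s}} → Coprime s t → (m : ℤ) →
  ∃₂ λ (i : ℤ) (j : ℕ) → j ℕ.< s × m ≡ i * + s + + j * + t
coprime⇒∃-linear-combination {s} {t} cop m with bézout-ℤ cop
... | x , y , xs+yt≡1 =
  m * x + q * + t , j , n%ℕd<d (m * y) s , sym (begin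
    (m * x + q * + t) * + s + + j * + t             ≡⟨ regroup m x y (+ j) q (+ s) (+ t) ⟩
    m * (x * + s + y * + t) + (+ j + q * + s - m * y) * + t
      ≡⟨ cong₂ (λ a b → m * a + (b - m * y) * + t) xs+yt≡1 (sym (a≡a%ℕn+[a/ℕn]*n (m * y) s)) ⟩
    m * + 1 + (m * y - m * y) * + t                 ≡⟨ collapse m (m * y) (+ t) ⟩
    m                                                ∎)
  where
  open ≡-Reasoning
  j = m * y %ℕ s
  q = m * y /ℕ s
  regroup : ∀ m x y j q s t →
    (m * x + q * t) * s + j * t ≡ m * (x * s + y * t) + (j + q * s - m * y) * t
  regroup = solve-∀
  collapse : ∀ m u t → m * + 1 + (u - u) * t ≡ m
  collapse = solve-∀

∣m-n∣<s : ∀ {m n s} → m ℕ.< s → n ℕ.< s → ∣ + m - + n ∣ ℕ.< s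
∣m-n∣<s {m} {n} m<s n<s = ℕ.≤-<-trans
  (subst (λ d → ∣ d ∣ ℕ.≤ m ℕ.⊔ n) (sym (ℤ.m-n≡m⊖n m n)) (ℤ.∣m⊝n∣≤m⊔n m n))
  (ℕ.⊔-lub m<s n<s)

∣∧<⇒≡0 : ∀ {s m} → s ∣ℕ m → m ℕ.< s → m ≡ 0
∣∧<⇒≡0 {m = 0}       _   _   = refl
∣∧<⇒≡0 {m = ℕ.suc _} s∣m m<s = contradiction s∣m (>⇒∤ m<s)

-- (j - j′) t = (i′ - i) s, so s ∣ j - j′ by coprimality, and |j - j′| < s forces j = j′.
coprime⇒linear-combination-unique : ∀ {s t} .{{_ : NonZero s}} → Coprime s t →
  ∀ {i i′} {j j′ : ℕ} → j ℕ.< s → j′ ℕ.< s →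
  i * + s + + j * + t ≡ i′ * + s + + j′ * + t → i ≡ i′ × j ≡ j′
coprime⇒linear-combination-unique {s} {t} cop {i} {i′} {j} {j′} j<s j′<s eq =
  i≡i′ , j≡j′
  where
  D = + j - + j′
  Dt≡[i′-i]s : D * + t ≡ (i′ - i) * + s
  Dt≡[i′-i]s = begin
    D * + t                                          ≡⟨ rearrange i (+ j) (+ j′) (+ s) (+ t) ⟩
    (i * + s + + j * + t) - (i * + s + + j′ * + t)   ≡⟨ cong (_- (i * + s + + j′ * + t)) eq ⟩
    (i′ * + s + + j′ * + t) - (i * + s + + j′ * + t) ≡⟨ cancel i i′ (+ j′) (+ s) (+ t) ⟩
    (i′ - i) * + s                                   ∎
    where
    open ≡-Reasoning
    rearrange : ∀ i j j′ s t → (j - j′) * t ≡ (i * s + j * t) - (i * s + j′ * t)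
    rearrange = solve-∀
    cancel : ∀ i i′ j′ s t → (i′ * s + j′ * t) - (i * s + j′ * t) ≡ (i′ - i) * s
    cancel = solve-∀
  s∣∣D∣ : s ∣ℕ ∣ D ∣
  s∣∣D∣ = coprime-divisor cop (divides ∣ i′ - i ∣ (begin
    t *ℕ ∣ D ∣          ≡⟨ ℕ.*-comm t ∣ D ∣ ⟩
    ∣ D ∣ *ℕ t          ≡⟨ ℤ.abs-* D (+ t) ⟨
    ∣ D * + t ∣         ≡⟨ cong ∣_∣ Dt≡[i′-i]s ⟩
    ∣ (i′ - i) * + s ∣  ≡⟨ ℤ.abs-* (i′ - i) (+ s) ⟩
    ∣ i′ - i ∣ *ℕ s     ∎))
    where open ≡-Reasoning
  D≡0 : D ≡ + 0
  D≡0 = ℤ.∣i∣≡0⇒i≡0 (∣∧<⇒≡0 s∣∣D∣ (∣m-n∣<s j<s j′<s))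
  j≡j′ : j ≡ j′
  j≡j′ = ℤ.+-injective (ℤ.i-j≡0⇒i≡j (+ j) (+ j′) D≡0)
  i≡i′ : i ≡ i′
  i≡i′ = sym (ℤ.i-j≡0⇒i≡j i′ i (ℤ.*-cancelʳ-≡ (i′ - i) (+ 0) (+ s)
    (trans (sym Dt≡[i′-i]s) (cong (_* + t) D≡0))))

1≤1+a+b⇒-b≤a : ∀ a b → 1ℤ ≤ 1ℤ + a + b → - b ≤ a
1≤1+a+b⇒-b≤a a b 1≤1+a+b = begin
  - b                        ≡⟨ shift b ⟩
  1ℤ - (1ℤ + b)              ≤⟨ ℤ.+-monoˡ-≤ (- (1ℤ + b)) 1≤1+a+b ⟩
  (1ℤ + a + b) - (1ℤ + b)    ≡⟨ cancel a b ⟩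
  a                          ∎
  where
  open ℤ.≤-Reasoning
  shift : ∀ b → - b ≡ 1ℤ - (1ℤ + b)
  shift = solve-∀
  cancel : ∀ a b → (1ℤ + a + b) - (1ℤ + b) ≡ a
  cancel = solve-∀

1+a+b≤c⇒a<c-b : ∀ a b {c} → 1ℤ + a + b ≤ c → a < c - b
1+a+b≤c⇒a<c-b a b {c} 1+a+b≤c = ℤ.suc[i]≤j⇒i<j (begin
  1ℤ + a                     ≡⟨ cancel a b ⟩
  (1ℤ + a + b) - b           ≤⟨ ℤ.+-monoˡ-≤ (- b) 1+a+b≤c ⟩
  c - b                      ∎)
  where
  open ℤ.≤-Reasoning
  cancel : ∀ a b → 1ℤ + a ≡ (1ℤ + a + b) - b
  cancel = solve-∀

4s+4t-jt≡4s+[4-j]t : ∀ s t j → + (4 *ℕ s +ℕ 4 *ℕ t) - j * + t ≡ + 4 * + s + (+ 4 - j) * + t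
4s+4t-jt≡4s+[4-j]t s t j = begin
  + (4 *ℕ s +ℕ 4 *ℕ t) - j * + t        ≡⟨ cong (_- j * + t) (ℤ.pos-+ (4 *ℕ s) (4 *ℕ t)) ⟩
  + (4 *ℕ s) + + (4 *ℕ t) - j * + t     ≡⟨ cong₂ (λ a b → a + b - j * + t) (ℤ.pos-* 4 s) (ℤ.pos-* 4 t) ⟩
  + 4 * + s + + 4 * + t - j * + t       ≡⟨ distrib (+ s) (+ t) j ⟩
  + 4 * + s + (+ 4 - j) * + t           ∎
  where
  open ≡-Reasoning
  distrib : ∀ s t j → + 4 * s + + 4 * t - j * t ≡ + 4 * s + (+ 4 - j) * t
  distrib = solve-∀

n≡1+a+b⇒n-1≡a+b : ∀ {n} a b → n ≡ 1ℤ + a + b → n - 1ℤ ≡ a + b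
n≡1+a+b⇒n-1≡a+b {n} a b eq = trans (cong (_- 1ℤ) eq) (cancel a b)
  where
  cancel : ∀ a b → 1ℤ + a + b - 1ℤ ≡ a + b
  cancel = solve-∀

n-1≡a+b⇒n≡1+a+b : ∀ {n} a b → n - 1ℤ ≡ a + b → n ≡ 1ℤ + a + b
n-1≡a+b⇒n≡1+a+b {n} a b eq = begin
  n              ≡⟨ restore n ⟩
  1ℤ + (n - 1ℤ)  ≡⟨ cong (_+_ 1ℤ) eq ⟩
  1ℤ + (a + b)   ≡⟨ ℤ.+-assoc 1ℤ a b ⟨
  1ℤ + a + b     ∎
  where
  open ≡-Reasoning
  restore : ∀ n → n ≡ 1ℤ + (n - 1ℤ)
  restore = solve-∀

Rep-intro : ∀ {s t n i j} → j ℕ.< s → n ≡ 1ℤ + i * + s + + j * + t →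
  1ℤ ≤ n → n ≤ + (4 *ℕ s +ℕ 4 *ℕ t) → Rep s t n i (+ j)
Rep-intro {s} {t} {i = i} {j} j<s n≡1+is+jt 1≤n n≤4s+4t =
  n≡1+is+jt , +≤+ ℕ.z≤n , +<+ j<s ,
  1≤1+a+b⇒-b≤a (i * + s) (+ j * + t) (subst (1ℤ ≤_) n≡1+is+jt 1≤n) ,
  subst (i * + s <_) (4s+4t-jt≡4s+[4-j]t s t (+ j))
    (1+a+b≤c⇒a<c-b (i * + s) (+ j * + t)
      (subst (_≤ + (4 *ℕ s +ℕ 4 *ℕ t)) n≡1+is+jt n≤4s+4t))

Rep-unique : ∀ {s t n i i′ j j′} .{{_ : NonZero s}} → Coprime s t →
  Rep s t n i j → Rep s t n i′ j′ → i ≡ i′ × j ≡ j′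
Rep-unique {s} {t} {n} {i} {i′} {+ j} {+ j′} cop
  (n≡1+is+jt , _ , +<+ j<s , _) (n≡1+i′s+j′t , _ , +<+ j′<s , _) =
  map₂ (cong (+_)) (coprime⇒linear-combination-unique cop j<s j′<s (begin
    i * + s + + j * + t     ≡⟨ n≡1+a+b⇒n-1≡a+b (i * + s) (+ j * + t) n≡1+is+jt ⟨
    n - 1ℤ                  ≡⟨ n≡1+a+b⇒n-1≡a+b (i′ * + s) (+ j′ * + t) n≡1+i′s+j′t ⟩
    i′ * + s + + j′ * + t   ∎))
  where open ≡-Reasoning

mainTheorem6 : (s t : ℕ) → NonZero s → NonZero t → gcd s t ≡ 1 →
    (n : ℤ) → + 1 ≤ n → n ≤ + (4 *ℕ s +ℕ 4 *ℕ t) →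
    Σ ℤ (λ i → Σ ℤ (λ j → Rep s t n i j
    × ((i′ j′ : ℤ) → Rep s t n i′ j′ → (i′ ≡ i) × (j′ ≡ j))))
mainTheorem6 s t s≢0 _ gcd≡1 n 1≤n n≤4s+4t =
  represent (coprime⇒∃-linear-combination ⦃ s≢0 ⦄ cop (n - 1ℤ))
  where
  cop : Coprime s t
  cop = gcd≡1⇒coprime gcd≡1
  represent : (∃₂ λ i j → j ℕ.< s × n - 1ℤ ≡ i * + s + + j * + t) →
    Σ ℤ (λ i → Σ ℤ (λ j → Rep s t n i j
    × ((i′ j′ : ℤ) → Rep s t n i′ j′ → (i′ ≡ i) × (j′ ≡ j))))
  represent (i , j , j<s , n-1≡is+jt) = i , + j , rep , λ i′ j′ rep′ →
    Rep-unique {i = i′} {i′ = i} {j = j′} {j′ = + j} ⦃ s≢0 ⦄ cop rep′ rep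
    where
    rep : Rep s t n i (+ j)
    rep = Rep-intro {i = i} j<s (n-1≡a+b⇒n≡1+a+b (i * + s) (+ j * + t) n-1≡is+jt) 1≤n n≤4s+4t
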